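{- Let $k\ge 1$ and let $(E,c)$ be a $k$-coloured graph, i.e. a directed graph $E=(E^0,E^1,r,s)$ with a colour map $c:E^1\to\{c_1,\dots,c_k\}$, together with a collection $\mathcal{C}$ of commuting squares (pairs $(ef,gh)$ of paths of length two with the same range and source, $c(e)=c(h)$, $c(f)=c(g)$, $c(e)\neq c(f)$). Let $\sim_1$ be an equivalence relation on $E^0\sqcup E^1$ such that for all $e,e'\in E^1$, $e\sim_1 e'$ implies $c(e)=c(e')$, $s(e)\sim_1 s(e')$ and $r(e)\sim_1 r(e')$. Extend $\sim_1$ to a relation $\sim$ on the set $E^*$ of finite paths as follows: $\sim_2$ on $E^0\sqcup E^1\sqcup E^2$ is given by $x\sim_2 y$ iff either $x=ef$, $y=e'f'$ with $e\sim_1 e'$ and $f\sim_1 f'$, or $x\sim_1 y$; for $n\ge 3$, $\sim_n$ on $\bigsqcup_{i=0}^n E^i$ is given by $x\sim_n y$ iff either $x=\alpha_1\cdots\alpha_n$, $y=\alpha_1'\cdots\alpha_n'$ are paths of length $n$ with $\alpha_1\cdots\alpha_{n-1}\sim_{n-1}\alpha_1'\cdots\alpha_{n-1}'$ and $\alpha_2\cdots\alpha_n\sim_{n-1}\alpha_2'\cdots\alpha_n'$, or $x\sim_{n-1}y$; and $\sim=\bigcup_n\sim_n$. Then $\sim$ is an equivalence relation on $E^*$. Moreover, setting $E/{\sim}=(E^0/{\sim},E^1/{\sim},r,s)$ with $r([e])=[r(e)]$, $s([e])=[s(e)]$ and $c([e])=c(e)$, these maps are well defined, $(E/{\sim},c)$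 is a $k$-coloured graph, and it carries the squares $\mathcal{C}/{\sim}=\{([e][f],[g][h]) : (ef,gh)\in\mathcal{C}\}$.
   Context: Paths are written so that a path $ef$ of length two satisfies $s(e)=r(f)$, with $r(ef)=r(e)$, $s(ef)=s(f)$; $E^n$ denotes paths of length $n$ and $E^*$ all finite paths (vertices being paths of length $0$). The colour of a path is the word of colours of its edges. -}

module Defs where

open import Data.Nat using (ℕ; zero; suc; _≤_)
open import Data.Fin using (Fin)
open import Data.Vec using (Vec; []; _∷_; init; tail)
open import Data.Product using (Σ; _×_; _,_; ∃)
open import Data.Unit using (⊤)
open import Data.Empty using (⊥)
open import Relation.Binary.PropositionalEquality using (_≡_; _≢_)
open import Relation.Binary.Structures using (IsEquivalence)
open import Data.Sum using (_⊎_)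

record ColouredGraph (k : ℕ) : Set₁ where
  field
    E⁰ : Set
    E¹ : Set
    r  : E¹ → E⁰
    s  : E¹ → E⁰
    c  : E¹ → Fin k

module Paths {k : ℕ} (G : ColouredGraph k) where
  open ColouredGraph G

  Composable : ∀ {n} → Vec E¹ n → Set
  Composable []            = ⊤
  Composable (e ∷ [])      = ⊤
  Composable (e ∷ f ∷ es)  = s e ≡ r f × Composable (f ∷ es)

  Path : ℕ → Set
  Path zero    = E⁰
  Path (suc m) = Σ (Vec E¹ (suc m)) Composable

  E* : Set
  E* = Σ ℕ Path

  IsSquare : Path 2 → Path 2 → Set
  IsSquare ((e ∷ f ∷ []) , _) ((g ∷ h ∷ []) , _) =
    r e ≡ r g × s f ≡ s h × c e ≡ c h × c f ≡ c g × c e ≢ c f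

  -- The extension of ∼₁ (given as ∼V on E⁰ and ∼E on E¹) to E*.
  module Extension (_∼V_ : E⁰ → E⁰ → Set) (_∼E_ : E¹ → E¹ → Set) where

    -- W n x y  means  x ∼_(n+1) y  for nonempty edge words x, y.
    -- level 1: x, y single edges with x ∼₁ y;
    -- level n+2: both of length n+2 with prefixes and suffixes ∼_(n+1)-related,
    --            or x ∼_(n+1) y.
    W : ℕ → ∀ {m m'} → Vec E¹ (suc m) → Vec E¹ (suc m') → Set
    W zero    {zero}  {zero}   (e ∷ []) (e' ∷ []) = e ∼E e'
    W zero    {_}     {_}      _        _         = ⊥
    W (suc n) {suc m} {suc m'} x y =
      (m ≡ n × m' ≡ n × W n (init x) (init y) × W n (tail x) (tail y)) ⊎ W n x y
    W (suc n) {_}     {_}      x y = W n x y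

    -- Sim n  is  ∼_(n+1)  on ⨆_{i ≤ n+1} Eⁱ  (as a relation on E*)
    Sim : ℕ → E* → E* → Set
    Sim n (zero  , v)     (zero   , w)     = v ∼V w
    Sim n (suc m , x , _) (suc m' , y , _) = W n x y
    Sim n _ _ = ⊥

    _∼_ : E* → E* → Set
    x ∼ y = ∃ λ n → Sim n x y

    vtx : E⁰ → E*
    vtx v = zero , v

    edge : E¹ → E*
    edge e = 1 , (e ∷ []) , _

    -- ([e][f], [g][h]) is a commuting square in the quotient graph E/∼
    IsQuotSquare : Path 2 → Path 2 → Set
    IsQuotSquare ((e ∷ f ∷ []) , _) ((g ∷ h ∷ []) , _) =
      vtx (s e) ∼ vtx (r f) × vtx (s g) ∼ vtx (r h) ×
      vtx (r e) ∼ vtx (r g) × vtx (s f) ∼ vtx (s h) ×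
      c e ≡ c h × c f ≡ c g × c e ≢ c f

-- The relation ∼ₙ₊₁ arises from ∼ₙ by adding pairs of paths of length exactly
-- n + 1, while ∼ₙ only relates paths of length at most n. So by induction on n
-- every ∼ₙ is an equivalence relation: in a chain x ∼ₙ₊₁ y ∼ₙ₊₁ z the two links
-- are either both new (compose prefixes and suffixes) or both old, since a new
-- link makes y too long for an old one. The levels increase, so their union ∼
-- is an equivalence relation too. On single edges ∼ is just ∼₁, which makes r, s
-- and c well defined on E/∼, and squares descend because equal vertices are
-- ∼-related.
module Submission where

open import Defs
open import Data.Nat using (ℕ; zero; suc; _≤_; _≤′_; ≤′-refl; ≤′-step; _⊔_; z≤n)
open import Data.Nat.Properties using (≤-reflexive; m≤n⇒m≤1+n; 1+n≰n; ≤⇒≤′; m≤m⊔n; m≤n⊔m)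
open import Data.Product using (_×_; _,_; proj₁; proj₂; map)
open import Data.Sum using (_⊎_; inj₁; inj₂) renaming (map to map⊎)
open import Data.Empty using (⊥; ⊥-elim)
open import Data.Vec using (Vec; []; _∷_; init; tail)
open import Relation.Binary.PropositionalEquality using (_≡_; refl)
open import Relation.Binary.Definitions using (Reflexive)
open import Relation.Binary.Structures using (IsEquivalence)

module ExtensionProperties {k : ℕ} (G : ColouredGraph k)
                           (_∼V_ : ColouredGraph.E⁰ G → ColouredGraph.E⁰ G → Set)
                           (_∼E_ : ColouredGraph.E¹ G → ColouredGraph.E¹ G → Set) where
  open ColouredGraph G
  open Paths G
  open Extension _∼V_ _∼E_

  private
    variable
      n n' m m' m″ : ℕ

  PrefixSuffix : ℕ → ∀ {m m'} → Vec E¹ (suc m) → Vec E¹ (suc m') → Set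
  PrefixSuffix n {suc m} {suc m'} x y =
    m ≡ n × m' ≡ n × W n (init x) (init y) × W n (tail x) (tail y)
  PrefixSuffix n _ _ = ⊥

  -- W (suc n) is defined by cases on the lengths; these two maps hide them.
  W-suc⇒ : ∀ n (x : Vec E¹ (suc m)) (y : Vec E¹ (suc m')) →
           W (suc n) x y → PrefixSuffix n x y ⊎ W n x y
  W-suc⇒ n (_ ∷ _ ∷ _) (_ ∷ _ ∷ _) w = w
  W-suc⇒ n (_ ∷ [])    _            w = inj₂ w
  W-suc⇒ n (_ ∷ _ ∷ _) (_ ∷ [])     w = inj₂ w

  ⇒W-suc : ∀ n (x : Vec E¹ (suc m)) (y : Vec E¹ (suc m')) →
           PrefixSuffix n x y ⊎ W n x y → W (suc n) x y
  ⇒W-suc n (_ ∷ _ ∷ _) (_ ∷ _ ∷ _) w        = w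
  ⇒W-suc n (_ ∷ [])    _            (inj₂ w) = w
  ⇒W-suc n (_ ∷ _ ∷ _) (_ ∷ [])     (inj₂ w) = w

  PrefixSuffix-length : ∀ n {x : Vec E¹ (suc m)} {y : Vec E¹ (suc m')} →
                        PrefixSuffix n x y → m ≡ suc n × m' ≡ suc n
  PrefixSuffix-length n {x = _ ∷ _ ∷ _} {y = _ ∷ _ ∷ _} (refl , refl , _) = refl , refl

  W-length : ∀ n {x : Vec E¹ (suc m)} {y : Vec E¹ (suc m')} → W n x y → m ≤ n × m' ≤ n
  W-length zero {x = _ ∷ []} {y = _ ∷ []} _ = z≤n , z≤n
  W-length (suc n) {x} {y} w with W-suc⇒ n x y w
  ... | inj₁ ps = map ≤-reflexive ≤-reflexive (PrefixSuffix-length n ps)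
  ... | inj₂ w′ = map m≤n⇒m≤1+n m≤n⇒m≤1+n (W-length n w′)

  length-clash : m ≡ suc n → m ≤ n → ⊥
  length-clash refl = 1+n≰n

  W-mono : ∀ {x : Vec E¹ (suc m)} {y : Vec E¹ (suc m')} → n ≤′ n' → W n x y → W n' x y
  W-mono                 ≤′-refl         w = w
  W-mono {x = x} {y = y} (≤′-step n≤′n') w = ⇒W-suc _ x y (inj₂ (W-mono n≤′n' w))

  W-edge : ∀ n {e e'} → W n (e ∷ []) (e' ∷ []) → e ∼E e'
  W-edge zero    w = w
  W-edge (suc n) w = W-edge n w

  module _ (∼E-isEquivalence : IsEquivalence _∼E_) where
    private module ∼E = IsEquivalence ∼E-isEquivalence

    W-refl : ∀ m (x : Vec E¹ (suc m)) → W m x x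
    W-refl zero    (e ∷ []) = ∼E.refl
    W-refl (suc m) x        = inj₁ (refl , refl , W-refl m (init x) , W-refl m (tail x))

    W-sym : ∀ n {x : Vec E¹ (suc m)} {y : Vec E¹ (suc m')} → W n x y → W n y x
    PrefixSuffix-sym : ∀ n {x : Vec E¹ (suc m)} {y : Vec E¹ (suc m')} →
                       PrefixSuffix n x y → PrefixSuffix n y x

    W-sym zero {x = _ ∷ []} {y = _ ∷ []} w = ∼E.sym w
    W-sym (suc n) {x} {y} w =
      ⇒W-suc n y x (map⊎ (PrefixSuffix-sym n) (W-sym n) (W-suc⇒ n x y w))

    PrefixSuffix-sym n {x = _ ∷ _ ∷ _} {y = _ ∷ _ ∷ _} (refl , refl , ∼init , ∼tail) =
      refl , refl , W-sym n ∼init , W-sym n ∼tail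

    W-trans : ∀ n {x : Vec E¹ (suc m)} {y : Vec E¹ (suc m')} {z : Vec E¹ (suc m″)} →
              W n x y → W n y z → W n x z
    PrefixSuffix-trans : ∀ n {x : Vec E¹ (suc m)} {y : Vec E¹ (suc m')} {z : Vec E¹ (suc m″)} →
                         PrefixSuffix n x y → PrefixSuffix n y z → PrefixSuffix n x z

    W-trans zero {x = _ ∷ []} {y = _ ∷ []} {z = _ ∷ []} v w = ∼E.trans v w
    W-trans (suc n) {x} {y} {z} v w with W-suc⇒ n x y v | W-suc⇒ n y z w
    ... | inj₁ ps | inj₁ ps′ = ⇒W-suc n x z (inj₁ (PrefixSuffix-trans n ps ps′))
    ... | inj₂ v′ | inj₂ w′  = ⇒W-suc n x z (inj₂ (W-trans n v′ w′))
    ... | inj₁ ps | inj₂ w′  =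
      ⊥-elim (length-clash (proj₂ (PrefixSuffix-length n ps)) (proj₁ (W-length n w′)))
    ... | inj₂ v′ | inj₁ ps  =
      ⊥-elim (length-clash (proj₁ (PrefixSuffix-length n ps)) (proj₂ (W-length n v′)))

    PrefixSuffix-trans n {x = _ ∷ _ ∷ _} {y = _ ∷ _ ∷ _} {z = _ ∷ _ ∷ _}
      (refl , refl , ∼init , ∼tail) (refl , refl , ∼init′ , ∼tail′) =
      refl , refl , W-trans n ∼init ∼init′ , W-trans n ∼tail ∼tail′

  Sim-mono : n ≤ n' → ∀ p q → Sim n p q → Sim n' p q
  Sim-mono n≤n' (zero  , _)     (zero  , _)     v∼w = v∼w
  Sim-mono n≤n' (suc _ , _ , _) (suc _ , _ , _) w   = W-mono (≤⇒≤′ n≤n') w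

  module _ (∼V-isEquivalence : IsEquivalence _∼V_) (∼E-isEquivalence : IsEquivalence _∼E_) where
    private module ∼V = IsEquivalence ∼V-isEquivalence

    ∼-refl : ∀ p → p ∼ p
    ∼-refl (zero  , v)     = 0 , ∼V.refl
    ∼-refl (suc m , x , _) = m , W-refl ∼E-isEquivalence m x

    Sim-sym : ∀ n p q → Sim n p q → Sim n q p
    Sim-sym n (zero  , _)     (zero  , _)     v∼w = ∼V.sym v∼w
    Sim-sym n (suc _ , _ , _) (suc _ , _ , _) w   = W-sym ∼E-isEquivalence n w

    Sim-trans : ∀ n p q r → Sim n p q → Sim n q r → Sim n p r
    Sim-trans n (zero  , _)     (zero  , _)     (zero  , _)     u∼v v∼w = ∼V.trans u∼v v∼w
    Sim-trans n (suc _ , _ , _) (suc _ , _ , _) (suc _ , _ , _) v   w   =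
      W-trans ∼E-isEquivalence n v w

    ∼-isEquivalence : IsEquivalence _∼_
    ∼-isEquivalence = record
      { refl  = λ {p} → ∼-refl p
      ; sym   = λ {p} {q} (n , p∼q) → n , Sim-sym n p q p∼q
      ; trans = λ {p} {q} {r} (n , p∼q) (n' , q∼r) →
          n ⊔ n' , Sim-trans (n ⊔ n') p q r (Sim-mono (m≤m⊔n n n') p q p∼q)
                                            (Sim-mono (m≤n⊔m n n') q r q∼r)
      }

  ∼-edge : ∀ {e e'} → edge e ∼ edge e' → e ∼E e'
  ∼-edge (n , w) = W-edge n w

  module _ (∼V-refl : Reflexive _∼V_) where

    ≡⇒vtx∼ : ∀ {v w} → v ≡ w → vtx v ∼ vtx w
    ≡⇒vtx∼ refl = 0 , ∼V-refl

    square⇒quotSquare : ∀ p q → IsSquare p q → IsQuotSquare p q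
    square⇒quotSquare ((e ∷ f ∷ []) , se≡rf , _) ((g ∷ h ∷ []) , sg≡rh , _)
                      (re≡rg , sf≡sh , ce≡ch , cf≡cg , ce≢cf) =
      ≡⇒vtx∼ se≡rf , ≡⇒vtx∼ sg≡rh , ≡⇒vtx∼ re≡rg , ≡⇒vtx∼ sf≡sh , ce≡ch , cf≡cg , ce≢cf

mainTheorem1 : (k : ℕ) → 1 ≤ k → (G : ColouredGraph k) →
    let open ColouredGraph G
        open Paths G
    in (C : Path 2 → Path 2 → Set) →
       (∀ p q → C p q → IsSquare p q) →
       (_∼V_ : E⁰ → E⁰ → Set) → (_∼E_ : E¹ → E¹ → Set) →
       IsEquivalence _∼V_ → IsEquivalence _∼E_ →
       (∀ e e' → e ∼E e' → (c e ≡ c e') × (s e ∼V s e') × (r e ∼V r e')) →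
       let open Extension _∼V_ _∼E_
       in IsEquivalence _∼_
          × (∀ e e' → edge e ∼ edge e' →
               (vtx (r e) ∼ vtx (r e')) × (vtx (s e) ∼ vtx (s e')) × (c e ≡ c e'))
          × (∀ p q → C p q → IsQuotSquare p q)
mainTheorem1 _ _ G _ C⊆squares _∼V_ _∼E_ ∼V-isEquivalence ∼E-isEquivalence compatible =
  ∼-isEquivalence ∼V-isEquivalence ∼E-isEquivalence ,
  edge∼⇒endpoints∼ ,
  λ p q pCq → square⇒quotSquare (IsEquivalence.refl ∼V-isEquivalence) p q (C⊆squares p q pCq)
  where
    open ColouredGraph G
    open Paths G
    open Extension _∼V_ _∼E_
    open ExtensionProperties G _∼V_ _∼E_

    edge∼⇒endpoints∼ : ∀ e e' → edge e ∼ edge e' →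
                       (vtx (r e) ∼ vtx (r e')) × (vtx (s e) ∼ vtx (s e')) × (c e ≡ c e')
    edge∼⇒endpoints∼ e e' e∼e' with compatible e e' (∼-edge e∼e')
    ... | ce≡ce' , se∼se' , re∼re' = (0 , re∼re') , (0 , se∼se') , ce≡ce'
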